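{- Let $n \in \mathbb{N}$ and let $\mathcal{F} \subseteq \mathcal{P}([n])$ be a nontrivial, union closed family. Then there is an up-set $\mathcal{U} \subseteq \mathcal{P}([n])$ with $\#\mathcal{U} \leq 2^{n-1}$ such that $$\#(\mathcal{F} \cap \mathcal{U}) \geq \frac{1}{2} \cdot \#\mathcal{F}.$$ -}

module Defs where

open import Data.Nat using (ℕ; zero; suc)
open import Data.Bool using (Bool; true; false; _∧_)
open import Data.Vec using ([]; _∷_)
open import Data.List using (List; []; _∷_; map; _++_; filterᵇ; length)
open import Data.Fin.Subset using (Subset; _∪_; _⊆_; Nonempty)
open import Data.Product using (∃; _×_)
open import Relation.Binary.PropositionalEquality using (_≡_)

-- A family of subsets of [n] = {0,…,n-1}, i.e. a subset of P([n]),
-- given by its characteristic function.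
Family : ℕ → Set
Family n = Subset n → Bool

_∈F_ : ∀ {n} → Subset n → Family n → Set
A ∈F 𝓕 = 𝓕 A ≡ true

allSubsets : (n : ℕ) → List (Subset n)
allSubsets zero = [] ∷ []
allSubsets (suc n) = map (false ∷_) (allSubsets n) ++ map (true ∷_) (allSubsets n)

#_ : ∀ {n} → Family n → ℕ
#_ {n} 𝓕 = length (filterᵇ 𝓕 (allSubsets n))

_∩F_ : ∀ {n} → Family n → Family n → Family n
(𝓕 ∩F 𝓖) A = 𝓕 A ∧ 𝓖 A

UnionClosed : ∀ {n} → Family n → Set
UnionClosed 𝓕 = ∀ A B → A ∈F 𝓕 → B ∈F 𝓕 → (A ∪ B) ∈F 𝓕

-- Nontrivial: 𝓕 contains a nonempty set (equivalently 𝓕 ≠ ∅ and 𝓕 ≠ {∅}).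
Nontrivial : ∀ {n} → Family n → Set
Nontrivial 𝓕 = ∃ λ A → A ∈F 𝓕 × Nonempty A

UpSet : ∀ {n} → Family n → Set
UpSet 𝓤 = ∀ A B → A ⊆ B → A ∈F 𝓤 → B ∈F 𝓤

-- For T ⊆ [n] let core T be the union of the members of 𝓕 inside T; as 𝓕 is union closed, it is the largest
-- member of 𝓕 ∪ {∅} contained in T. Let weight A be the number of T with core T = A. The weights of the sets in
-- 𝓕 ∪ {∅} add up to 2^n, and T ↦ (T ─ B) ∪ A shows that A ⊆ B implies weight B ≤ weight A.
--
-- List the nonempty members of 𝓕 by increasing weight, larger sets first among equal weights. Every prefix X of
-- this list is closed upwards within 𝓕, so the up-set U generated by X satisfies #U ≤ Σ_X weight (the core of
-- every T ∈ U lies in X) and #(𝓕 ∩ U) ≥ |X|. Take for X the first ⌈#𝓕/2⌉ sets. Comparing the light half of the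
-- list with the heavy half, with weight ∅ as the extra term when X has one set more, gives 2 Σ_X weight ≤ 2^n.
-- This count fails only when ∅ ∈ 𝓕 and there are evenly many nonempty members. Then #𝓕 is odd, so 𝓕 is not closed
-- under B ↦ ⋃𝓕 ─ B, which would pair the members containing a point with those avoiding it. A member B with
-- ⋃𝓕 ─ B ∉ 𝓕 yields Q = B ∪ core (⋃𝓕 ─ B) ⊊ ⋃𝓕 with weight ⋃𝓕 + weight Q ≤ weight ∅, and since ⋃𝓕 heads the
-- list and Q is no lighter than the second set, this pays for the extra set.

module Submission where

open import Defs
open import Data.Nat using (ℕ; zero; suc; _+_; _*_; _∸_; _^_; _≤_; _<_; z≤n; s≤s)
open import Data.Nat.Properties
  using ( ≤-trans; ≤-reflexive; ≤-antisym; <⇒≱; <-irrefl; n≤0⇒n≡0; n≤1+n; m≤m+n; m≤n⇒m⊓n≡m; m⊓n≤m; m+n∸m≡n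
        ; +-comm; +-assoc; +-suc; +-identityʳ; +-mono-≤; +-monoˡ-≤; +-monoʳ-≤; *-distribˡ-+; *-monoʳ-≤; *-cancelˡ-≤
        ; even≢odd; ≤-decTotalOrder; module ≤-Reasoning)
open import Data.Nat.ListAction using (sum)
open import Data.Nat.ListAction.Properties using (sum-++)
open import Data.Nat.Solver using (module +-*-Solver)
open +-*-Solver using (solve; _:+_; _:*_; _:=_; con)
open import Data.Bool using (Bool; true; false; not; _∧_; T?)
import Data.Bool as Bool
open import Data.Bool.Properties using (T-≡)
open import Data.Empty using () renaming (⊥ to ⊥₀)
open import Data.Fin using (Fin)
open import Data.Fin.Subset using (Subset; _∉_; _⊆_; _⊂_; _∪_; _─_; ⊥; ⊤; ⋃; ∁; ∣_∣; Nonempty) renaming (_∈_ to _∈ₛ_)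
open import Data.Fin.Subset.Properties
  using ( nonempty?; Empty-unique; _⊆?_; ⊆-refl; ⊆-trans; ⊆-antisym; ∉⊥; ⊥⊆; ⊆⊤; p⊆p∪q; q⊆p∪q; x∈p∪q⁻; ∪-identityʳ
        ; x∈p∧x∉q⇒x∈p─q; p─q⊆p; p─⊥≡p; p⊂q⇒∣p∣<∣q∣; p⊂q⇒∁p⊃∁q)
  renaming (_∈?_ to _∈ₛ?_)
open import Data.List using (List; []; _∷_; _++_; map; length; take; drop; filterᵇ)
open import Data.List.Properties
  using (length-++; length-map; length-filter; length-take; length-drop; take++drop≡id; take-map; filter-none)
open import Data.List.Membership.Propositional using (_∈_; lose; find)
open import Data.List.Membership.Propositional.Properties
  using (∈-∃++; ∈-++⁻; ∈-++⁺ˡ; ∈-++⁺ʳ; ∈-map⁺; ∈-map⁻; ∈-filter⁺; ∈-filter⁻; ∈-length)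
open import Data.List.Relation.Binary.Permutation.Propositional using (↭⇒↭ₛ; ↭-sym)
open import Data.List.Relation.Binary.Permutation.Propositional.Properties using (∈-resp-↭; ↭-length)
import Data.List.Relation.Binary.Permutation.Setoid.Properties as Permutationₛ
open import Data.List.Relation.Unary.All as All using (All; []; _∷_)
import Data.List.Relation.Unary.All.Properties as Allₚ
open import Data.List.Relation.Unary.AllPairs as AllPairs using (AllPairs; []; _∷_)
import Data.List.Relation.Unary.AllPairs.Properties as AllPairsₚ
open import Data.List.Relation.Unary.Any using (here; there; any?; satisfied)
open import Data.List.Relation.Unary.Unique.Propositional using (Unique)
import Data.List.Relation.Unary.Unique.Propositional.Properties as Uniqueₚ
open import Data.List.Relation.Unary.Sorted.TotalOrder.Properties using (Sorted⇒AllPairs)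
import Data.List.Sort as Sort
open import Data.Product using (∃; _×_; _,_; proj₁; proj₂)
open import Data.Product.Relation.Binary.Lex.NonStrict using (×-decTotalOrder)
open import Data.Sum using (_⊎_; inj₁; inj₂)
open import Data.Vec using ([]; _∷_) renaming (here to hereᵥ; there to thereᵥ)
open import Data.Vec.Properties using (≡-dec)
open import Function using (_∘_; Equivalence; case_of_)
open import Relation.Binary.Bundles using (DecTotalOrder)
import Relation.Binary.Construct.On as On
open import Relation.Binary.PropositionalEquality
open import Relation.Binary.PropositionalEquality.Properties using (setoid)
open import Relation.Nullary using (Dec; yes; no; ¬_; does; contradiction)
open import Relation.Nullary.Decidable using (dec-true; decidable-stable)

private variable
  A : Set
  R : A → A → Set
  n : ℕ
  x : Fin n
  p q r : Subset n

even-or-odd : ∀ m → ∃ λ k → m ≡ 2 * k ⊎ m ≡ suc (2 * k)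
even-or-odd zero = 0 , inj₁ refl
even-or-odd (suc m) with even-or-odd m
... | k , inj₁ refl = k , inj₂ refl
... | k , inj₂ refl = suc k , inj₁ (cong suc (sym (+-suc k (k + 0))))

∧-true⁺ : ∀ {a b} → a ≡ true → b ≡ true → a ∧ b ≡ true
∧-true⁺ refl refl = refl

∧-true⁻ : ∀ {a b} → a ∧ b ≡ true → a ≡ true × b ≡ true
∧-true⁻ {true} b≡true = refl , b≡true

not-true⁺ : ∀ {a} → a ≢ true → not a ≡ true
not-true⁺ {false} _      = refl
not-true⁺ {true}  a≢true = contradiction refl a≢true

not-true⁻ : ∀ {a} → not a ≡ true → a ≢ true
not-true⁻ {false} _ ()

length-filterᵇ-split : ∀ (p q : A → Bool) xs →
  length (filterᵇ p xs) ≡ length (filterᵇ (λ x → p x ∧ q x) xs) + length (filterᵇ (λ x → p x ∧ not (q x)) xs)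
length-filterᵇ-split p q [] = refl
length-filterᵇ-split p q (x ∷ xs) with p x | q x
... | false | _     = length-filterᵇ-split p q xs
... | true  | true  = cong suc (length-filterᵇ-split p q xs)
... | true  | false = trans (cong suc (length-filterᵇ-split p q xs)) (sym (+-suc _ _))

length-unique-⊆ : ∀ {xs ys : List A} → Unique xs → (∀ {x} → x ∈ xs → x ∈ ys) → length xs ≤ length ys
length-unique-⊆ {xs = []} _ _ = z≤n
length-unique-⊆ {xs = x ∷ xs} (x∉xs ∷ xs!) xs⊆ys with ∈-∃++ (xs⊆ys (here refl))
... | ys₁ , ys₂ , refl = begin
  suc (length xs)               ≤⟨ s≤s (length-unique-⊆ xs! xs⊆ys₁++ys₂) ⟩
  suc (length (ys₁ ++ ys₂))     ≡⟨ cong suc (length-++ ys₁) ⟩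
  suc (length ys₁ + length ys₂) ≡⟨ +-suc (length ys₁) (length ys₂) ⟨
  length ys₁ + length (x ∷ ys₂) ≡⟨ length-++ ys₁ ⟨
  length (ys₁ ++ x ∷ ys₂)       ∎
  where
  open ≤-Reasoning
  xs⊆ys₁++ys₂ : ∀ {y} → y ∈ xs → y ∈ ys₁ ++ ys₂
  xs⊆ys₁++ys₂ y∈xs with ∈-++⁻ ys₁ (xs⊆ys (there y∈xs))
  ... | inj₁ y∈ys₁         = ∈-++⁺ˡ y∈ys₁
  ... | inj₂ (here refl)   = contradiction refl (All.lookup x∉xs y∈xs)
  ... | inj₂ (there y∈ys₂) = ∈-++⁺ʳ ys₁ y∈ys₂

unique-map : ∀ {f g : A → A} {xs} → (∀ {x} → x ∈ xs → g (f x) ≡ x) → Unique xs → Unique (map f xs)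
unique-map {xs = []} _ [] = []
unique-map {f = f} {g} {x ∷ xs} g∘f≗id (x∉xs ∷ xs!) = fx∉fxs ∷ unique-map {g = g} (g∘f≗id ∘ there) xs!
  where
  fx≢fy : ∀ {y} → y ∈ xs → f x ≢ f y
  fx≢fy {y} y∈xs fx≡fy = All.lookup x∉xs y∈xs (begin
    x       ≡⟨ g∘f≗id (here refl) ⟨
    g (f x) ≡⟨ cong g fx≡fy ⟩
    g (f y) ≡⟨ g∘f≗id (there y∈xs) ⟩
    y       ∎)
    where open ≡-Reasoning
  fx∉fxs : All (f x ≢_) (map f xs)
  fx∉fxs = Allₚ.map⁺ (All.tabulate fx≢fy)

∈-take : ∀ j {xs : List A} {x} → x ∈ take j xs → x ∈ xs
∈-take j {xs} x∈ = subst (_ ∈_) (take++drop≡id j xs) (∈-++⁺ˡ x∈)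

∈-drop : ∀ j {xs : List A} {x} → x ∈ drop j xs → x ∈ xs
∈-drop j {xs} x∈ = subst (_ ∈_) (take++drop≡id j xs) (∈-++⁺ʳ (take j xs) x∈)

∈-take⊎∈-drop : ∀ j {xs : List A} {x} → x ∈ xs → x ∈ take j xs ⊎ x ∈ drop j xs
∈-take⊎∈-drop j {xs} x∈ = ∈-++⁻ (take j xs) (subst (_ ∈_) (sym (take++drop≡id j xs)) x∈)

AllPairs-take-drop : ∀ j {xs : List A} → AllPairs R xs → ∀ {x y} → x ∈ take j xs → y ∈ drop j xs → R x y
AllPairs-take-drop (suc j) {_ ∷ xs} (x≤xs ∷ _)  (here refl) y∈ = All.lookup x≤xs (∈-drop j y∈)
AllPairs-take-drop (suc j) {_ ∷ xs} (_ ∷ xs↗) (there x∈)  y∈ = AllPairs-take-drop j xs↗ x∈ y∈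

length-take≤ : ∀ j (xs : List A) → length (take j xs) ≤ j
length-take≤ j xs = ≤-trans (≤-reflexive (length-take j xs)) (m⊓n≤m j _)

length-take≡ : ∀ j (xs : List A) → j ≤ length xs → length (take j xs) ≡ j
length-take≡ j xs j≤ = trans (length-take j xs) (m≤n⇒m⊓n≡m j≤)

length-drop-+ : ∀ j k (xs : List A) → length xs ≡ j + k → length (drop j xs) ≡ k
length-drop-+ j k xs ∣xs∣ = trans (length-drop j xs) (trans (cong (_∸ j) ∣xs∣) (m+n∸m≡n j k))

length≡2+⇒∷∷ : ∀ (xs : List A) {m} → length xs ≡ 2 + m →
               ∃ λ a → ∃ λ b → ∃ λ rest → xs ≡ a ∷ b ∷ rest × length rest ≡ m
length≡2+⇒∷∷ (a ∷ b ∷ rest) refl = a , b , rest , refl , refl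

sum-≤-sum : ∀ {as bs : List ℕ} → (∀ {a b} → a ∈ as → b ∈ bs → a ≤ b) → length as ≤ length bs → sum as ≤ sum bs
sum-≤-sum {[]}     _ _ = z≤n
sum-≤-sum {_ ∷ _} {_ ∷ _} as≤bs (s≤s ∣as∣≤∣bs∣) =
  +-mono-≤ (as≤bs (here refl) (here refl)) (sum-≤-sum (λ a∈ b∈ → as≤bs (there a∈) (there b∈)) ∣as∣≤∣bs∣)

sum-take+sum-drop : ∀ j (ws : List ℕ) → sum (take j ws) + sum (drop j ws) ≡ sum ws
sum-take+sum-drop j ws = trans (sym (sum-++ (take j ws) (drop j ws))) (cong sum (take++drop≡id j ws))

sorted⇒2*sum-take≤sum : ∀ k {ws : List ℕ} → AllPairs _≤_ ws → length ws ≡ 2 * k → 2 * sum (take k ws) ≤ sum ws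
sorted⇒2*sum-take≤sum k {ws} ws↗ ∣ws∣ = begin
  2 * sum (take k ws)               ≡⟨ cong (sum (take k ws) +_) (+-identityʳ _) ⟩
  sum (take k ws) + sum (take k ws) ≤⟨ +-monoʳ-≤ _ (sum-≤-sum (AllPairs-take-drop k ws↗) ∣take∣≤∣drop∣) ⟩
  sum (take k ws) + sum (drop k ws) ≡⟨ sum-take+sum-drop k ws ⟩
  sum ws                            ∎
  where
  open ≤-Reasoning
  ∣take∣≤∣drop∣ : length (take k ws) ≤ length (drop k ws)
  ∣take∣≤∣drop∣ = ≤-trans (length-take≤ k ws)
    (≤-reflexive (sym (length-drop-+ k k ws (trans ∣ws∣ (cong (k +_) (+-identityʳ k))))))

sorted⇒2*sum-take≤sum+bound : ∀ k {ws : List ℕ} {W} → AllPairs _≤_ ws → All (_≤ W) ws → length ws ≡ suc (2 * k) →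
                               2 * sum (take (suc k) ws) ≤ sum ws + W
sorted⇒2*sum-take≤sum+bound k {ws} {W} ws↗ ws≤W ∣ws∣ = begin
  2 * sum t           ≡⟨ cong (sum t +_) (+-identityʳ _) ⟩
  sum t + sum t       ≤⟨ +-monoʳ-≤ (sum t) (sum-≤-sum t≤W∷d ∣t∣≤∣W∷d∣) ⟩
  sum t + (W + sum d) ≡⟨ cong (sum t +_) (+-comm W (sum d)) ⟩
  sum t + (sum d + W) ≡⟨ +-assoc (sum t) (sum d) W ⟨
  sum t + sum d + W   ≡⟨ cong (_+ W) (sum-take+sum-drop (suc k) ws) ⟩
  sum ws + W          ∎
  where
  open ≤-Reasoning
  t = take (suc k) ws
  d = drop (suc k) ws
  t≤W∷d : ∀ {a b} → a ∈ t → b ∈ W ∷ d → a ≤ b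
  t≤W∷d a∈ (here refl) = All.lookup ws≤W (∈-take (suc k) a∈)
  t≤W∷d a∈ (there b∈)  = AllPairs-take-drop (suc k) ws↗ a∈ b∈
  ∣t∣≤∣W∷d∣ : length t ≤ length (W ∷ d)
  ∣t∣≤∣W∷d∣ = ≤-trans (length-take≤ (suc k) ws)
    (≤-reflexive (cong suc (sym (length-drop-+ (suc k) k ws (trans ∣ws∣ (cong (λ m → suc (k + m)) (+-identityʳ k)))))))

sorted⇒2*sum-take≤sum+first-two : ∀ k {u v} {ws : List ℕ} → AllPairs _≤_ (u ∷ v ∷ ws) → length ws ≡ 2 * k →
                                   2 * sum (take (2 + k) (u ∷ v ∷ ws)) ≤ sum (u ∷ v ∷ ws) + (u + v)
sorted⇒2*sum-take≤sum+first-two k {u} {v} {ws} (_ ∷ _ ∷ ws↗) ∣ws∣ = begin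
  2 * (u + (v + t))            ≡⟨ solve 3 (λ u v t → con 2 :* (u :+ (v :+ t)) := (u :+ (v :+ con 2 :* t)) :+ (u :+ v))
                                        refl u v t ⟩
  (u + (v + 2 * t)) + (u + v)  ≤⟨ +-monoˡ-≤ (u + v) (+-monoʳ-≤ u (+-monoʳ-≤ v (sorted⇒2*sum-take≤sum k ws↗ ∣ws∣))) ⟩
  (u + (v + sum ws)) + (u + v) ∎
  where
  open ≤-Reasoning
  t = sum (take k ws)

x∈p─q⇒x∉q : ∀ (p q : Subset n) → x ∈ₛ p ─ q → x ∉ q
x∈p─q⇒x∉q (_ ∷ p) (false ∷ q) hereᵥ = λ ()
x∈p─q⇒x∉q (_ ∷ p) (_ ∷ q) (thereᵥ x∈p─q) (thereᵥ x∈q) = x∈p─q⇒x∉q p q x∈p─q x∈q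

x∈p─q⁻ : ∀ (p q : Subset n) → x ∈ₛ p ─ q → x ∈ₛ p × x ∉ q
x∈p─q⁻ p q x∈p─q = p─q⊆p p q x∈p─q , x∈p─q⇒x∉q p q x∈p─q

∪-least : p ⊆ r → q ⊆ r → p ∪ q ⊆ r
∪-least {p = p} {q = q} p⊆r q⊆r x∈p∪q with x∈p∪q⁻ p q x∈p∪q
... | inj₁ x∈p = p⊆r x∈p
... | inj₂ x∈q = q⊆r x∈q

⊆⊥⇒≡⊥ : p ⊆ ⊥ → p ≡ ⊥
⊆⊥⇒≡⊥ p⊆⊥ = Empty-unique λ (_ , x∈p) → ∉⊥ (p⊆⊥ x∈p)

Nonempty⇒≢⊥ : Nonempty p → p ≢ ⊥
Nonempty⇒≢⊥ (_ , x∈p) refl = ∉⊥ x∈p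

≢⊥⇒Nonempty : p ≢ ⊥ → Nonempty p
≢⊥⇒Nonempty {p = p} p≢⊥ with nonempty? p
... | yes p≠∅ = p≠∅
... | no  p=∅ = contradiction (Empty-unique p=∅) p≢⊥

⊆∧≢⇒⊂ : p ⊆ q → p ≢ q → p ⊂ q
⊆∧≢⇒⊂ {p = p} {q} p⊆q p≢q with nonempty? (q ─ p)
... | yes (x , x∈q─p) = p⊆q , x , x∈p─q⁻ q p x∈q─p
... | no  q─p=∅       = contradiction (⊆-antisym p⊆q q⊆p) p≢q
  where
  q⊆p : q ⊆ p
  q⊆p {x} x∈q with x ∈ₛ? p
  ... | yes x∈p = x∈p
  ... | no  x∉p = contradiction (x , x∈p∧x∉q⇒x∈p─q x∈q x∉p) q─p=∅

⊆-⋃ : ∀ {xs : List (Subset n)} → p ∈ xs → p ⊆ ⋃ xs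
⊆-⋃ {xs = q ∷ xs} (here refl)  = p⊆p∪q (⋃ xs)
⊆-⋃ {xs = q ∷ xs} (there p∈xs) = ⊆-trans (⊆-⋃ p∈xs) (q⊆p∪q q (⋃ xs))

⋃-least : ∀ {xs : List (Subset n)} → All (_⊆ p) xs → ⋃ xs ⊆ p
⋃-least []           = ⊥⊆
⋃-least (q⊆p ∷ xs⊆p) = ∪-least q⊆p (⋃-least xs⊆p)

─∪-∪-cancel : q ⊆ p → r ⊆ q → ((p ─ q) ∪ r) ∪ q ≡ p
─∪-∪-cancel {q = q} {p} {r} q⊆p r⊆q = ⊆-antisym (∪-least (∪-least (p─q⊆p p q) (⊆-trans r⊆q q⊆p)) q⊆p) p⊆
  where
  p⊆ : p ⊆ ((p ─ q) ∪ r) ∪ q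
  p⊆ {x} x∈p with x ∈ₛ? q
  ... | yes x∈q = q⊆p∪q _ q x∈q
  ... | no  x∉q = p⊆p∪q q (p⊆p∪q r (x∈p∧x∉q⇒x∈p─q x∈p x∉q))

p─[p─q]≡q : q ⊆ p → p ─ (p ─ q) ≡ q
p─[p─q]≡q {q = q} {p} q⊆p = ⊆-antisym ⊆q q⊆
  where
  ⊆q : p ─ (p ─ q) ⊆ q
  ⊆q {x} x∈ with x∈p─q⁻ p (p ─ q) x∈ | x ∈ₛ? q
  ... | _         , _      | yes x∈q = x∈q
  ... | x∈p , x∉p─q | no  x∉q = contradiction (x∈p∧x∉q⇒x∈p─q x∈p x∉q) x∉p─q
  q⊆ : q ⊆ p ─ (p ─ q)
  q⊆ x∈q = x∈p∧x∉q⇒x∈p─q (q⊆p x∈q) (λ x∈p─q → proj₂ (x∈p─q⁻ p q x∈p─q) x∈q)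

-- Counting subfamilies of P([n])

∈-allSubsets : ∀ n (A : Subset n) → A ∈ allSubsets n
∈-allSubsets zero    []          = here refl
∈-allSubsets (suc n) (false ∷ A) = ∈-++⁺ˡ (∈-map⁺ (false ∷_) (∈-allSubsets n A))
∈-allSubsets (suc n) (true ∷ A)  = ∈-++⁺ʳ _ (∈-map⁺ (true ∷_) (∈-allSubsets n A))

allSubsets-unique : ∀ n → Unique (allSubsets n)
allSubsets-unique zero    = [] ∷ []
allSubsets-unique (suc n) =
  Uniqueₚ.++⁺ (Uniqueₚ.map⁺ ∷-injectiveʳ (allSubsets-unique n)) (Uniqueₚ.map⁺ ∷-injectiveʳ (allSubsets-unique n))
              disjoint
  where
  ∷-injectiveʳ : ∀ {b} {A B : Subset n} → b ∷ A ≡ b ∷ B → A ≡ B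
  ∷-injectiveʳ refl = refl
  disjoint : ∀ {A} → A ∈ map (false ∷_) (allSubsets n) × A ∈ map (true ∷_) (allSubsets n) → ⊥₀
  disjoint (A∈₀ , A∈₁) with ∈-map⁻ _ A∈₀ | ∈-map⁻ _ A∈₁
  ... | _ , _ , refl | _ , _ , ()

length-allSubsets : ∀ n → length (allSubsets n) ≡ 2 ^ n
length-allSubsets zero    = refl
length-allSubsets (suc n) = begin
  length (map (false ∷_) (allSubsets n) ++ map (true ∷_) (allSubsets n))
    ≡⟨ length-++ (map (false ∷_) (allSubsets n)) ⟩
  length (map (false ∷_) (allSubsets n)) + length (map (true ∷_) (allSubsets n))
    ≡⟨ cong₂ _+_ (length-map _ (allSubsets n)) (length-map _ (allSubsets n)) ⟩
  length (allSubsets n) + length (allSubsets n)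
    ≡⟨ cong₂ _+_ (length-allSubsets n) (trans (length-allSubsets n) (sym (+-identityʳ _))) ⟩
  2 ^ suc n ∎
  where open ≡-Reasoning

module _ {n : ℕ} where

  private variable
    𝓕 𝓖 : Family n
    B : Subset n

  _≟ₛ_ : (A B : Subset n) → Dec (A ≡ B)
  _≟ₛ_ = ≡-dec Bool._≟_

  open import Data.List.Membership.DecPropositional _≟ₛ_ using (_∈?_)

  infix 4 _⊆F_
  _⊆F_ : Family n → Family n → Set
  𝓕 ⊆F 𝓖 = ∀ {A} → A ∈F 𝓕 → A ∈F 𝓖

  ∁F : Family n → Family n
  ∁F 𝓕 A = not (𝓕 A)

  -- Opaque, so that unification sees decFamily P? A rather than the Boolean it unfolds to.
  opaque
    decFamily : {P : Subset n → Set} → (∀ A → Dec (P A)) → Family n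
    decFamily P? A = does (P? A)

    ∈-decFamily⁺ : ∀ {P : Subset n → Set} (P? : ∀ A → Dec (P A)) → P B → B ∈F decFamily P?
    ∈-decFamily⁺ P? = dec-true (P? _)

    ∈-decFamily⁻ : ∀ {P : Subset n → Set} (P? : ∀ A → Dec (P A)) → B ∈F decFamily P? → P B
    ∈-decFamily⁻ {B = B} P? B∈ with P? B
    ... | yes PB = PB

  members : Family n → List (Subset n)
  members 𝓕 = filterᵇ 𝓕 (allSubsets n)

  ∈-members⁺ : B ∈F 𝓕 → B ∈ members 𝓕
  ∈-members⁺ {𝓕 = 𝓕} B∈𝓕 = ∈-filter⁺ (T? ∘ 𝓕) (∈-allSubsets n _) (Equivalence.from T-≡ B∈𝓕)

  ∈-members⁻ : B ∈ members 𝓕 → B ∈F 𝓕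
  ∈-members⁻ {𝓕 = 𝓕} B∈ = Equivalence.to T-≡ (proj₂ (∈-filter⁻ (T? ∘ 𝓕) {xs = allSubsets n} B∈))

  members-unique : ∀ 𝓕 → Unique (members 𝓕)
  members-unique 𝓕 = Uniqueₚ.filter⁺ (T? ∘ 𝓕) (allSubsets-unique n)

  #≤2^n : ∀ 𝓕 → # 𝓕 ≤ 2 ^ n
  #≤2^n 𝓕 = ≤-trans (length-filter (T? ∘ 𝓕) (allSubsets n)) (≤-reflexive (length-allSubsets n))

  unique⇒length≤# : ∀ 𝓕 {xs} → Unique xs → All (_∈F 𝓕) xs → length xs ≤ # 𝓕
  unique⇒length≤# 𝓕 xs! xs⊆𝓕 = length-unique-⊆ xs! (∈-members⁺ {𝓕 = 𝓕} ∘ All.lookup xs⊆𝓕)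

  #-mono : 𝓕 ⊆F 𝓖 → # 𝓕 ≤ # 𝓖
  #-mono {𝓕} {𝓖} 𝓕⊆𝓖 = unique⇒length≤# 𝓖 (members-unique 𝓕) (All.tabulate (𝓕⊆𝓖 ∘ ∈-members⁻))

  #-cong : 𝓕 ⊆F 𝓖 → 𝓖 ⊆F 𝓕 → # 𝓕 ≡ # 𝓖
  #-cong 𝓕⊆𝓖 𝓖⊆𝓕 = ≤-antisym (#-mono 𝓕⊆𝓖) (#-mono 𝓖⊆𝓕)

  #-injection : (f g : Subset n → Subset n) → (∀ {A} → A ∈F 𝓕 → f A ∈F 𝓖) →
                (∀ {A} → A ∈F 𝓕 → g (f A) ≡ A) → # 𝓕 ≤ # 𝓖
  #-injection {𝓕} {𝓖} f g f∈𝓖 g∘f≗id = begin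
    # 𝓕                        ≡⟨ length-map f (members 𝓕) ⟨
    length (map f (members 𝓕)) ≤⟨ unique⇒length≤# 𝓖 f[𝓕]! (Allₚ.map⁺ (All.tabulate (f∈𝓖 ∘ ∈-members⁻))) ⟩
    # 𝓖                        ∎
    where
    open ≤-Reasoning
    f[𝓕]! : Unique (map f (members 𝓕))
    f[𝓕]! = unique-map {g = g} (g∘f≗id ∘ ∈-members⁻) (members-unique 𝓕)

  #-split : ∀ 𝓕 𝓖 → # 𝓕 ≡ # (𝓕 ∩F 𝓖) + # (𝓕 ∩F ∁F 𝓖)
  #-split 𝓕 𝓖 = length-filterᵇ-split 𝓕 𝓖 (allSubsets n)

  #-atMostOne : ∀ 𝓖 {A} → (∀ {B} → B ∈F 𝓖 → B ≡ A) → # 𝓖 ≤ 1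
  #-atMostOne 𝓖 {A} 𝓖⊆A =
    length-unique-⊆ {ys = A ∷ []} (members-unique 𝓖) (λ B∈ → here (𝓖⊆A (∈-members⁻ B∈)))

  #-none : ∀ 𝓖 → (∀ {B} → ¬ B ∈F 𝓖) → # 𝓖 ≡ 0
  #-none 𝓖 𝓖=∅ = n≤0⇒n≡0
    (length-unique-⊆ {xs = members 𝓖} {ys = []} (members-unique 𝓖) (λ B∈ → contradiction (∈-members⁻ B∈) 𝓖=∅))

  ∃F? : ∀ 𝓖 → (∃ λ A → A ∈F 𝓖) ⊎ (∀ {A} → ¬ A ∈F 𝓖)
  ∃F? 𝓖 with any? (λ A → 𝓖 A Bool.≟ true) (allSubsets n)
  ... | yes ∃A = inj₁ (satisfied ∃A)
  ... | no  ∄A = inj₂ λ A∈ → ∄A (lose (∈-allSubsets n _) A∈)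

  fibre : (Subset n → Subset n) → Subset n → Family n
  fibre φ A = decFamily (λ T → φ T ≟ₛ A)

  preimage : (Subset n → Subset n) → List (Subset n) → Family n
  preimage φ xs = decFamily (λ T → φ T ∈? xs)

  module _ {φ : Subset n → Subset n} {T : Subset n} where

    ∈-fibre⁺ : ∀ {A} → φ T ≡ A → T ∈F fibre φ A
    ∈-fibre⁺ = ∈-decFamily⁺ (λ T → φ T ≟ₛ _)

    ∈-fibre⁻ : ∀ {A} → T ∈F fibre φ A → φ T ≡ A
    ∈-fibre⁻ = ∈-decFamily⁻ (λ T → φ T ≟ₛ _)

    ∈-preimage⁺ : ∀ {xs} → φ T ∈ xs → T ∈F preimage φ xs
    ∈-preimage⁺ = ∈-decFamily⁺ (λ T → φ T ∈? _)

    ∈-preimage⁻ : ∀ {xs} → T ∈F preimage φ xs → φ T ∈ xs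
    ∈-preimage⁻ = ∈-decFamily⁻ (λ T → φ T ∈? _)

  #-preimage : ∀ (φ : Subset n → Subset n) {xs} → Unique xs →
               # (preimage φ xs) ≡ sum (map (λ A → # (fibre φ A)) xs)
  #-preimage φ {[]} [] = cong length (filter-none (T? ∘ preimage φ []) {xs = allSubsets n}
    (All.tabulate λ _ T∈ → case ∈-preimage⁻ (Equivalence.to T-≡ T∈) of λ ()))
  #-preimage φ {x ∷ xs} (x∉xs ∷ xs!) = begin
    # (preimage φ (x ∷ xs))
      ≡⟨ #-split (preimage φ (x ∷ xs)) (fibre φ x) ⟩
    # (preimage φ (x ∷ xs) ∩F fibre φ x) + # (preimage φ (x ∷ xs) ∩F ∁F (fibre φ x))
      ≡⟨ cong₂ _+_ (#-cong (proj₂ ∘ ∧-true⁻) on-x) (#-cong off-x off-x⁻¹) ⟩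
    # (fibre φ x) + # (preimage φ xs)
      ≡⟨ cong (# (fibre φ x) +_) (#-preimage φ xs!) ⟩
    sum (map (λ A → # (fibre φ A)) (x ∷ xs)) ∎
    where
    open ≡-Reasoning
    on-x : fibre φ x ⊆F preimage φ (x ∷ xs) ∩F fibre φ x
    on-x T∈ = ∧-true⁺ (∈-preimage⁺ (here (∈-fibre⁻ T∈))) T∈
    off-x : preimage φ (x ∷ xs) ∩F ∁F (fibre φ x) ⊆F preimage φ xs
    off-x T∈ with ∧-true⁻ T∈
    ... | T∈x∷xs , T∉x with ∈-preimage⁻ T∈x∷xs
    ...   | here φT≡x   = contradiction (∈-fibre⁺ φT≡x) (not-true⁻ T∉x)
    ...   | there φT∈xs = ∈-preimage⁺ φT∈xs
    off-x⁻¹ : preimage φ xs ⊆F preimage φ (x ∷ xs) ∩F ∁F (fibre φ x)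
    off-x⁻¹ T∈ = ∧-true⁺ (∈-preimage⁺ (there φT∈xs))
                         (not-true⁺ λ T∈x → All.lookup x∉xs φT∈xs (sym (∈-fibre⁻ T∈x)))
      where φT∈xs = ∈-preimage⁻ T∈

  #-complementClosed : ∀ (𝓕 : Family n) {M : Subset n} {x} → x ∈ₛ M →
    (∀ {B} → B ∈F 𝓕 → B ⊆ M) → (∀ {B} → B ∈F 𝓕 → (M ─ B) ∈F 𝓕) →
    # 𝓕 ≡ 2 * # (𝓕 ∩F decFamily (x ∈ₛ?_))
  #-complementClosed 𝓕 {M} {x} x∈M 𝓕⊆M M─𝓕⊆𝓕 = begin
    # 𝓕                           ≡⟨ #-split 𝓕 ∋x ⟩
    # (𝓕 ∩F ∋x) + # (𝓕 ∩F ∁F ∋x) ≡⟨ cong (# (𝓕 ∩F ∋x) +_) (≤-antisym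
                                     (#-injection (M ─_) (M ─_) out→in (involutive {∁F ∋x}))
                                     (#-injection (M ─_) (M ─_) in→out (involutive {∋x}))) ⟩
    # (𝓕 ∩F ∋x) + # (𝓕 ∩F ∋x)    ≡⟨ cong (# (𝓕 ∩F ∋x) +_) (+-identityʳ _) ⟨
    2 * # (𝓕 ∩F ∋x)              ∎
    where
    open ≡-Reasoning
    ∋x : Family n
    ∋x = decFamily (x ∈ₛ?_)
    involutive : ∀ {𝓖 B} → B ∈F (𝓕 ∩F 𝓖) → M ─ (M ─ B) ≡ B
    involutive B∈ = p─[p─q]≡q (𝓕⊆M (proj₁ (∧-true⁻ B∈)))
    in→out : ∀ {B} → B ∈F (𝓕 ∩F ∋x) → (M ─ B) ∈F (𝓕 ∩F ∁F ∋x)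
    in→out B∈ with ∧-true⁻ B∈
    ... | B∈𝓕 , x∈B = ∧-true⁺ (M─𝓕⊆𝓕 B∈𝓕) (not-true⁺ λ x∈M─B →
                        proj₂ (x∈p─q⁻ M _ (∈-decFamily⁻ (x ∈ₛ?_) x∈M─B)) (∈-decFamily⁻ (x ∈ₛ?_) x∈B))
    out→in : ∀ {B} → B ∈F (𝓕 ∩F ∁F ∋x) → (M ─ B) ∈F (𝓕 ∩F ∋x)
    out→in B∈ with ∧-true⁻ B∈
    ... | B∈𝓕 , x∉B = ∧-true⁺ (M─𝓕⊆𝓕 B∈𝓕) (∈-decFamily⁺ (x ∈ₛ?_)
                        (x∈p∧x∉q⇒x∈p─q x∈M λ x∈B → not-true⁻ x∉B (∈-decFamily⁺ (x ∈ₛ?_) x∈B)))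

  upClosure : List (Subset n) → Family n
  upClosure X = decFamily (λ T → any? (_⊆? T) X)

  ∈-upClosure⁺ : ∀ {X A T} → A ∈ X → A ⊆ T → T ∈F upClosure X
  ∈-upClosure⁺ A∈X A⊆T = ∈-decFamily⁺ (λ T → any? (_⊆? T) _) (lose A∈X A⊆T)

  ∈-upClosure⁻ : ∀ {X T} → T ∈F upClosure X → ∃ λ A → A ∈ X × A ⊆ T
  ∈-upClosure⁻ T∈ = find (∈-decFamily⁻ (λ T → any? (_⊆? T) _) T∈)

  upClosure-UpSet : ∀ X → UpSet (upClosure X)
  upClosure-UpSet X S T S⊆T S∈ with ∈-upClosure⁻ S∈
  ... | A , A∈X , A⊆S = ∈-upClosure⁺ A∈X (⊆-trans A⊆S S⊆T)

-- Cores and weights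

module CoreDecomposition {n : ℕ} (𝓕 : Family n) (𝓕-∪ : UnionClosed 𝓕) where

  Member₀ : Subset n → Set
  Member₀ A = A ≡ ⊥ ⊎ A ∈F 𝓕

  ⋃-Member₀ : ∀ {xs} → All (_∈F 𝓕) xs → Member₀ (⋃ xs)
  ⋃-Member₀ [] = inj₁ refl
  ⋃-Member₀ {x ∷ xs} (x∈𝓕 ∷ xs⊆𝓕) with ⋃-Member₀ xs⊆𝓕
  ... | inj₁ ⋃xs≡⊥ = inj₂ (subst (_∈F 𝓕) (sym (trans (cong (x ∪_) ⋃xs≡⊥) (∪-identityʳ x))) x∈𝓕)
  ... | inj₂ ⋃xs∈𝓕 = inj₂ (𝓕-∪ x (⋃ xs) x∈𝓕 ⋃xs∈𝓕)

  membersWithin : Subset n → List (Subset n)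
  membersWithin T = members (𝓕 ∩F decFamily (_⊆? T))

  ∈-membersWithin⁺ : ∀ {A T} → A ∈F 𝓕 → A ⊆ T → A ∈ membersWithin T
  ∈-membersWithin⁺ A∈𝓕 A⊆T = ∈-members⁺ (∧-true⁺ A∈𝓕 (∈-decFamily⁺ (_⊆? _) A⊆T))

  ∈-membersWithin⁻ : ∀ {A T} → A ∈ membersWithin T → A ∈F 𝓕 × A ⊆ T
  ∈-membersWithin⁻ {T = T} A∈ with ∧-true⁻ (∈-members⁻ {𝓕 = 𝓕 ∩F decFamily (_⊆? T)} A∈)
  ... | A∈𝓕 , A⊆T = A∈𝓕 , ∈-decFamily⁻ (_⊆? T) A⊆T

  core : Subset n → Subset n
  core T = ⋃ (membersWithin T)

  core-⊆ : ∀ T → core T ⊆ T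
  core-⊆ T = ⋃-least (All.tabulate (proj₂ ∘ ∈-membersWithin⁻))

  ⊆-core : ∀ {A T} → A ∈F 𝓕 → A ⊆ T → A ⊆ core T
  ⊆-core A∈𝓕 A⊆T = ⊆-⋃ (∈-membersWithin⁺ A∈𝓕 A⊆T)

  core-Member₀ : ∀ T → Member₀ (core T)
  core-Member₀ T = ⋃-Member₀ (All.tabulate (proj₁ ∘ ∈-membersWithin⁻))

  core-unique : ∀ {A T} → A ⊆ T → Member₀ A → (∀ {B} → B ∈F 𝓕 → B ⊆ T → B ⊆ A) → core T ≡ A
  core-unique {A} {T} A⊆T A∈₀ maximal = ⊆-antisym core⊆A (A⊆core A∈₀)
    where
    core⊆A : core T ⊆ A
    core⊆A with core-Member₀ T
    ... | inj₁ core≡⊥ = subst (_⊆ A) (sym core≡⊥) ⊥⊆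
    ... | inj₂ core∈𝓕 = maximal core∈𝓕 (core-⊆ T)
    A⊆core : Member₀ A → A ⊆ core T
    A⊆core (inj₁ refl) = ⊥⊆
    A⊆core (inj₂ A∈𝓕) = ⊆-core A∈𝓕 A⊆T

  core-shift : ∀ {A B T} → core T ≡ B → A ⊆ B → Member₀ A → core ((T ─ B) ∪ A) ≡ A
  core-shift {A} {B} {T} refl A⊆B A∈₀ = core-unique (q⊆p∪q _ A) A∈₀ maximal
    where
    maximal : ∀ {E} → E ∈F 𝓕 → E ⊆ (T ─ B) ∪ A → E ⊆ A
    maximal E∈𝓕 E⊆ x∈E with x∈p∪q⁻ (T ─ B) A (E⊆ x∈E)
    ... | inj₂ x∈A   = x∈A
    ... | inj₁ x∈T─B = contradiction (⊆-core E∈𝓕 E⊆T x∈E) (proj₂ (x∈p─q⁻ T B x∈T─B))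
      where E⊆T = ⊆-trans E⊆ (∪-least (p─q⊆p T B) (⊆-trans A⊆B (core-⊆ T)))

  weight : Subset n → ℕ
  weight A = # (fibre core A)

  weight-antitone : ∀ {A B} → A ⊆ B → Member₀ A → weight B ≤ weight A
  weight-antitone {A} {B} A⊆B A∈₀ = #-injection (λ T → (T ─ B) ∪ A) (_∪ B)
    (λ T∈ → ∈-fibre⁺ (core-shift (∈-fibre⁻ T∈) A⊆B A∈₀))
    (λ {T} T∈ → ─∪-∪-cancel (subst (_⊆ T) (∈-fibre⁻ T∈) (core-⊆ T)) A⊆B)

  ⋃𝓕 : Subset n
  ⋃𝓕 = core ⊤

  ⊆-⋃𝓕 : ∀ {A} → A ∈F 𝓕 → A ⊆ ⋃𝓕
  ⊆-⋃𝓕 A∈𝓕 = ⊆-core A∈𝓕 ⊆⊤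

  odd⇒complementDefect : ∀ {k x} → x ∈ₛ ⋃𝓕 → # 𝓕 ≡ suc (2 * k) → ∃ λ B → B ∈F 𝓕 × ¬ (⋃𝓕 ─ B) ∈F 𝓕
  odd⇒complementDefect {k} {x} x∈⋃𝓕 #𝓕-odd with ∃F? (𝓕 ∩F ∁F (λ B → 𝓕 (⋃𝓕 ─ B)))
  ... | inj₁ (B , B∈) = B , proj₁ (∧-true⁻ {𝓕 B} B∈) , not-true⁻ (proj₂ (∧-true⁻ {𝓕 B} B∈))
  ... | inj₂ none = contradiction (trans (sym (#-complementClosed 𝓕 x∈⋃𝓕 ⊆-⋃𝓕 ⋃𝓕─B∈𝓕)) #𝓕-odd)
                                  (even≢odd (# (𝓕 ∩F decFamily (x ∈ₛ?_))) k)
    where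
    ⋃𝓕─B∈𝓕 : ∀ {B} → B ∈F 𝓕 → (⋃𝓕 ─ B) ∈F 𝓕
    ⋃𝓕─B∈𝓕 B∈𝓕 = decidable-stable (𝓕 _ Bool.≟ true) λ ⋃𝓕─B∉𝓕 → none (∧-true⁺ B∈𝓕 (not-true⁺ ⋃𝓕─B∉𝓕))

  module WithEmpty (⊥∈𝓕 : ⊥ ∈F 𝓕) where

    Member₀⇒∈ : ∀ {A} → Member₀ A → A ∈F 𝓕
    Member₀⇒∈ (inj₁ refl) = ⊥∈𝓕
    Member₀⇒∈ (inj₂ A∈𝓕) = A∈𝓕

    core-∈ : ∀ T → core T ∈F 𝓕
    core-∈ T = Member₀⇒∈ (core-Member₀ T)

    -- Split the fibre of ∅ according to whether T contains ⋃𝓕 ─ Q: T ↦ (T ─ ⋃𝓕) ∪ (⋃𝓕 ─ Q) embeds the fibre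
    -- of ⋃𝓕 into the first part, and T ↦ T ─ Q embeds the fibre of Q into the second.
    weight-⋃𝓕+weight≤weight-⊥ : ∀ {Q} → Q ⊆ ⋃𝓕 → Q ≢ ⋃𝓕 → core (⋃𝓕 ─ Q) ≡ ⊥ →
                                weight ⋃𝓕 + weight Q ≤ weight ⊥
    weight-⋃𝓕+weight≤weight-⊥ {Q} Q⊆M Q≢M core[M─Q]≡⊥ = begin
      weight M + weight Q
        ≤⟨ +-mono-≤ (#-injection g₁ (_∪ M) g₁-into (λ T∈ → ─∪-∪-cancel (core≡⇒⊆ T∈) (p─q⊆p M Q)))
                    (#-injection g₂ (_∪ Q) g₂-into (λ T∈ → ─∪-∪-cancel (core≡⇒⊆ T∈) ⊥⊆)) ⟩
      # (fibre core ⊥ ∩F covers) + # (fibre core ⊥ ∩F ∁F covers)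
        ≡⟨ #-split (fibre core ⊥) covers ⟨
      weight ⊥ ∎
      where
      open ≤-Reasoning
      M = ⋃𝓕
      covers : Family n
      covers = decFamily ((M ─ Q) ⊆?_)
      core≡⇒⊆ : ∀ {T A} → T ∈F fibre core A → A ⊆ T
      core≡⇒⊆ {T} T∈ = subst (_⊆ T) (∈-fibre⁻ T∈) (core-⊆ T)
      g₁ g₂ : Subset n → Subset n
      g₁ T = (T ─ M) ∪ (M ─ Q)
      g₂ T = (T ─ Q) ∪ ⊥
      g₁-into : ∀ {T} → T ∈F fibre core M → g₁ T ∈F (fibre core ⊥ ∩F covers)
      g₁-into {T} _ = ∧-true⁺ (∈-fibre⁺ (core-unique ⊥⊆ (inj₁ refl) maximal)) (∈-decFamily⁺ ((M ─ Q) ⊆?_) (q⊆p∪q _ _))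
        where
        maximal : ∀ {E} → E ∈F 𝓕 → E ⊆ g₁ T → E ⊆ ⊥
        maximal {E} E∈𝓕 E⊆ = subst (E ⊆_) core[M─Q]≡⊥ (⊆-core E∈𝓕 E⊆M─Q)
          where
          E⊆M─Q : E ⊆ M ─ Q
          E⊆M─Q x∈E with x∈p∪q⁻ (T ─ M) (M ─ Q) (E⊆ x∈E)
          ... | inj₁ x∈T─M = contradiction (⊆-⋃𝓕 E∈𝓕 x∈E) (proj₂ (x∈p─q⁻ T M x∈T─M))
          ... | inj₂ x∈M─Q = x∈M─Q
      g₂-into : ∀ {T} → T ∈F fibre core Q → g₂ T ∈F (fibre core ⊥ ∩F ∁F covers)
      g₂-into {T} T∈ = ∧-true⁺ (∈-fibre⁺ (core-shift (∈-fibre⁻ T∈) ⊥⊆ (inj₁ refl)))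
                               (not-true⁺ λ g₂T∈ → Q≢M (⊆-antisym Q⊆M (M⊆Q (∈-decFamily⁻ ((M ─ Q) ⊆?_) g₂T∈))))
        where
        M⊆Q : M ─ Q ⊆ g₂ T → M ⊆ Q
        M⊆Q M─Q⊆ = subst (M ⊆_) (∈-fibre⁻ T∈) (⊆-core (core-∈ ⊤) M⊆T)
          where
          M⊆T : M ⊆ T
          M⊆T {x} x∈M with x ∈ₛ? Q
          ... | yes x∈Q = core≡⇒⊆ T∈ x∈Q
          ... | no  x∉Q = p─q⊆p T Q (subst (_ ∈ₛ_) (∪-identityʳ (T ─ Q)) (M─Q⊆ (x∈p∧x∉q⇒x∈p─q x∈M x∉Q)))

    module ComplementDefect {B} (B∈𝓕 : B ∈F 𝓕) (M─B∉𝓕 : ¬ (⋃𝓕 ─ B) ∈F 𝓕) where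

      private
        M = ⋃𝓕
        C = core (M ─ B)

      Q : Subset n
      Q = B ∪ C

      Q∈𝓕 : Q ∈F 𝓕
      Q∈𝓕 = 𝓕-∪ B C B∈𝓕 (core-∈ (M ─ B))

      Q≢⊥ : Q ≢ ⊥
      Q≢⊥ Q≡⊥ = M─B∉𝓕 (subst (λ B → (M ─ B) ∈F 𝓕) (sym B≡⊥) (subst (_∈F 𝓕) (sym (p─⊥≡p M)) (core-∈ ⊤)))
        where B≡⊥ = ⊆⊥⇒≡⊥ (subst (B ⊆_) Q≡⊥ (p⊆p∪q C))

      Q⊆M : Q ⊆ M
      Q⊆M = ∪-least (⊆-⋃𝓕 B∈𝓕) (⊆-trans (core-⊆ (M ─ B)) (p─q⊆p M B))

      Q≢M : Q ≢ M
      Q≢M Q≡M = M─B∉𝓕 (subst (_∈F 𝓕) (⊆-antisym (core-⊆ (M ─ B)) M─B⊆C) (core-∈ (M ─ B)))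
        where
        M─B⊆C : M ─ B ⊆ C
        M─B⊆C x∈M─B with x∈p─q⁻ M B x∈M─B
        ... | x∈M , x∉B with x∈p∪q⁻ B C (subst (_ ∈ₛ_) (sym Q≡M) x∈M)
        ...   | inj₁ x∈B = contradiction x∈B x∉B
        ...   | inj₂ x∈C = x∈C

      core[M─Q]≡⊥ : core (M ─ Q) ≡ ⊥
      core[M─Q]≡⊥ = core-unique ⊥⊆ (inj₁ refl) maximal
        where
        maximal : ∀ {E} → E ∈F 𝓕 → E ⊆ M ─ Q → E ⊆ ⊥
        maximal {E} E∈𝓕 E⊆M─Q x∈E = contradiction (q⊆p∪q B C (⊆-core E∈𝓕 E⊆M─B x∈E)) (proj₂ (x∈p─q⁻ M Q (E⊆M─Q x∈E)))
          where
          E⊆M─B : E ⊆ M ─ B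
          E⊆M─B y∈E with x∈p─q⁻ M Q (E⊆M─Q y∈E)
          ... | y∈M , y∉Q = x∈p∧x∉q⇒x∈p─q y∈M (λ y∈B → y∉Q (p⊆p∪q C y∈B))

-- Selecting the light half

module Selection {n : ℕ} (𝓕 : Family n) (𝓕-∪ : UnionClosed 𝓕) where

  open CoreDecomposition 𝓕 𝓕-∪

  𝓕⁺ : Family n
  𝓕⁺ = 𝓕 ∩F ∁F (decFamily (_≟ₛ ⊥))

  -- Ties in weight are broken in favour of larger sets, so that a proper superset always comes first (⊂⇒≰ₖ).
  key : Subset n → ℕ × ℕ
  key A = weight A , ∣ ∁ A ∣

  keyOrder : DecTotalOrder _ _ _
  keyOrder = On.decTotalOrder (×-decTotalOrder ≤-decTotalOrder ≤-decTotalOrder) key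

  open DecTotalOrder keyOrder using () renaming (_≤_ to _≤ₖ_; totalOrder to keyTotalOrder)
  open Sort keyOrder using (sort; sort-↭; sort-↗)

  ≤ₖ⇒weight≤ : ∀ {A B} → A ≤ₖ B → weight A ≤ weight B
  ≤ₖ⇒weight≤ (inj₁ (wA≤wB , _)) = wA≤wB
  ≤ₖ⇒weight≤ (inj₂ (wA≡wB , _)) = ≤-reflexive wA≡wB

  ⊂⇒≰ₖ : ∀ {A B} → A ⊂ B → A ∈F 𝓕 → ¬ A ≤ₖ B
  ⊂⇒≰ₖ A⊂B A∈𝓕 (inj₁ (wA≤wB , wA≢wB)) = wA≢wB (≤-antisym wA≤wB (weight-antitone (proj₁ A⊂B) (inj₂ A∈𝓕)))
  ⊂⇒≰ₖ A⊂B _   (inj₂ (_ , ∣∁A∣≤∣∁B∣))  = <⇒≱ (p⊂q⇒∣p∣<∣q∣ (p⊂q⇒∁p⊃∁q A⊂B)) ∣∁A∣≤∣∁B∣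

  -- Opaque, so that with-abstraction over goals mentioning ranked does not normalise the sort.
  opaque
    ranked : List (Subset n)
    ranked = sort (members 𝓕⁺)

    ranked-sorted : AllPairs _≤ₖ_ ranked
    ranked-sorted = Sorted⇒AllPairs keyTotalOrder (sort-↗ _)

    ranked-unique : Unique ranked
    ranked-unique = Permutationₛ.Unique-resp-↭ (setoid (Subset n)) (↭⇒↭ₛ (↭-sym (sort-↭ _))) (members-unique 𝓕⁺)

    ∈-ranked⁺ : ∀ {A} → A ∈F 𝓕 → A ≢ ⊥ → A ∈ ranked
    ∈-ranked⁺ A∈𝓕 A≢⊥ =
      ∈-resp-↭ (↭-sym (sort-↭ _)) (∈-members⁺ (∧-true⁺ A∈𝓕 (not-true⁺ (A≢⊥ ∘ ∈-decFamily⁻ (_≟ₛ ⊥)))))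

    ∈-ranked⁻ : ∀ {A} → A ∈ ranked → A ∈F 𝓕 × A ≢ ⊥
    ∈-ranked⁻ A∈ with ∧-true⁻ (∈-members⁻ {𝓕 = 𝓕⁺} (∈-resp-↭ (sort-↭ _) A∈))
    ... | A∈𝓕 , A≢⊥ = A∈𝓕 , not-true⁻ A≢⊥ ∘ ∈-decFamily⁺ (_≟ₛ ⊥)

    length-ranked : length ranked ≡ # 𝓕⁺
    length-ranked = ↭-length (sort-↭ _)

  sum-weights+weight-⊥≤2^n : sum (map weight ranked) + weight ⊥ ≤ 2 ^ n
  sum-weights+weight-⊥≤2^n = begin
    sum (map weight ranked) + weight ⊥ ≡⟨ +-comm _ (weight ⊥) ⟩
    weight ⊥ + sum (map weight ranked) ≡⟨ #-preimage core (All.tabulate ⊥≢ ∷ ranked-unique) ⟨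
    # (preimage core (⊥ ∷ ranked))     ≤⟨ #≤2^n (preimage core (⊥ ∷ ranked)) ⟩
    2 ^ n                              ∎
    where
    open ≤-Reasoning
    ⊥≢ : ∀ {A} → A ∈ ranked → ⊥ ≢ A
    ⊥≢ A∈ ⊥≡A = proj₂ (∈-ranked⁻ A∈) (sym ⊥≡A)

  private
    is⊥ : Family n
    is⊥ = decFamily (_≟ₛ ⊥)

    #𝓕≡ : # 𝓕 ≡ # (𝓕 ∩F is⊥) + length ranked
    #𝓕≡ = trans (#-split 𝓕 is⊥) (cong (# (𝓕 ∩F is⊥) +_) (sym length-ranked))

    ∈𝓕∩is⊥⇒≡⊥ : ∀ {A} → A ∈F (𝓕 ∩F is⊥) → A ≡ ⊥
    ∈𝓕∩is⊥⇒≡⊥ = ∈-decFamily⁻ (_≟ₛ ⊥) ∘ proj₂ ∘ ∧-true⁻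

  #𝓕≤1+length-ranked : # 𝓕 ≤ 1 + length ranked
  #𝓕≤1+length-ranked = ≤-trans (≤-reflexive #𝓕≡) (+-monoˡ-≤ (length ranked) (#-atMostOne (𝓕 ∩F is⊥) ∈𝓕∩is⊥⇒≡⊥))

  #𝓕≡length-ranked : ¬ ⊥ ∈F 𝓕 → # 𝓕 ≡ length ranked
  #𝓕≡length-ranked ⊥∉𝓕 = trans #𝓕≡ (cong (_+ length ranked) (#-none (𝓕 ∩F is⊥) λ A∈ →
    ⊥∉𝓕 (subst (_∈F 𝓕) (∈𝓕∩is⊥⇒≡⊥ A∈) (proj₁ (∧-true⁻ A∈)))))

  #𝓕≡1+length-ranked : ⊥ ∈F 𝓕 → # 𝓕 ≡ 1 + length ranked
  #𝓕≡1+length-ranked ⊥∈𝓕 = trans #𝓕≡ (cong (_+ length ranked) (≤-antisym (#-atMostOne (𝓕 ∩F is⊥) ∈𝓕∩is⊥⇒≡⊥)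
    (unique⇒length≤# (𝓕 ∩F is⊥) (All.[] ∷ AllPairs.[]) (∧-true⁺ ⊥∈𝓕 (∈-decFamily⁺ (_≟ₛ ⊥) refl) ∷ []))))

  take-upClosed : ∀ j {A B} → A ∈ take j ranked → B ∈F 𝓕 → A ⊆ B → B ∈ take j ranked
  take-upClosed j {A} {B} A∈X B∈𝓕 A⊆B with A ≟ₛ B
  ... | yes refl = A∈X
  ... | no A≢B with ∈-take⊎∈-drop j (∈-ranked⁺ B∈𝓕 B≢⊥)
    where
    B≢⊥ : B ≢ ⊥
    B≢⊥ refl = proj₂ (∈-ranked⁻ (∈-take j A∈X)) (⊆⊥⇒≡⊥ A⊆B)
  ...   | inj₁ B∈X    = B∈X
  ...   | inj₂ B∈rest = contradiction (AllPairs-take-drop j ranked-sorted A∈X B∈rest)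
                                      (⊂⇒≰ₖ (⊆∧≢⇒⊂ A⊆B A≢B) (proj₁ (∈-ranked⁻ (∈-take j A∈X))))

  #upClosure-take≤sum : ∀ j → # (upClosure (take j ranked)) ≤ sum (map weight (take j ranked))
  #upClosure-take≤sum j = ≤-trans (#-mono {𝓕 = upClosure X} U⊆core⁻¹[X])
                                  (≤-reflexive (#-preimage core (AllPairsₚ.take⁺ j ranked-unique)))
    where
    X = take j ranked
    U⊆core⁻¹[X] : upClosure X ⊆F preimage core X
    U⊆core⁻¹[X] {T} T∈ with ∈-upClosure⁻ T∈
    ... | A , A∈X , A⊆T with core-Member₀ T | ⊆-core (proj₁ (∈-ranked⁻ (∈-take j A∈X))) A⊆T
    ...   | inj₁ core≡⊥ | A⊆core = contradiction (⊆⊥⇒≡⊥ (subst (A ⊆_) core≡⊥ A⊆core)) (proj₂ (∈-ranked⁻ (∈-take j A∈X)))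
    ...   | inj₂ core∈𝓕 | A⊆core = ∈-preimage⁺ (take-upClosed j A∈X core∈𝓕 A⊆core)

  length-take≤#∩upClosure : ∀ j → length (take j ranked) ≤ # (𝓕 ∩F upClosure (take j ranked))
  length-take≤#∩upClosure j = unique⇒length≤# (𝓕 ∩F upClosure (take j ranked)) (AllPairsₚ.take⁺ j ranked-unique)
    (All.tabulate λ A∈X → ∧-true⁺ (proj₁ (∈-ranked⁻ (∈-take j A∈X))) (∈-upClosure⁺ A∈X ⊆-refl))

  private
    sorted-from : ∀ {A rest} → ranked ≡ A ∷ rest → AllPairs _≤ₖ_ (A ∷ rest)
    sorted-from ranked≡ = subst (AllPairs _≤ₖ_) ranked≡ ranked-sorted

  head-ranked : ∀ {A₁ rest} → ranked ≡ A₁ ∷ rest → ⋃𝓕 ∈ ranked → A₁ ≡ ⋃𝓕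
  head-ranked {A₁} ranked≡ ⋃𝓕∈ with subst (⋃𝓕 ∈_) ranked≡ ⋃𝓕∈ | A₁ ≟ₛ ⋃𝓕
  ... | here ⋃𝓕≡A₁    | _          = sym ⋃𝓕≡A₁
  ... | there _        | yes A₁≡⋃𝓕 = A₁≡⋃𝓕
  ... | there ⋃𝓕∈rest | no  A₁≢⋃𝓕 =
    contradiction (All.lookup (AllPairs.head (sorted-from ranked≡)) ⋃𝓕∈rest) (⊂⇒≰ₖ (⊆∧≢⇒⊂ (⊆-⋃𝓕 A₁∈𝓕) A₁≢⋃𝓕) A₁∈𝓕)
    where A₁∈𝓕 = proj₁ (∈-ranked⁻ (subst (A₁ ∈_) (sym ranked≡) (here refl)))

  weight-first-two≤weight-⊥ : ⊥ ∈F 𝓕 → ∀ {k} → # 𝓕 ≡ suc (2 * k) →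
    ∀ {A₁ A₂ rest} → ranked ≡ A₁ ∷ A₂ ∷ rest → weight A₁ + weight A₂ ≤ weight ⊥
  weight-first-two≤weight-⊥ ⊥∈𝓕 {k} #𝓕-odd {A₁} {A₂} {rest} ranked≡ with odd⇒complementDefect {k} i∈⋃𝓕 #𝓕-odd
    where
    A₁∈ranked = subst (A₁ ∈_) (sym ranked≡) (here refl)
    i∈⋃𝓕 = ⊆-⋃𝓕 (proj₁ (∈-ranked⁻ A₁∈ranked)) (proj₂ (≢⊥⇒Nonempty (proj₂ (∈-ranked⁻ A₁∈ranked))))
  ... | B , B∈𝓕 , ⋃𝓕─B∉𝓕 = begin
    weight A₁ + weight A₂ ≤⟨ +-mono-≤ (≤-reflexive (cong weight A₁≡⋃𝓕)) wA₂≤wQ ⟩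
    weight ⋃𝓕 + weight Q  ≤⟨ weight-⋃𝓕+weight≤weight-⊥ Q⊆M Q≢M core[M─Q]≡⊥ ⟩
    weight ⊥              ∎
    where
    open ≤-Reasoning
    open WithEmpty ⊥∈𝓕
    open ComplementDefect B∈𝓕 ⋃𝓕─B∉𝓕
    A₁≡⋃𝓕 : A₁ ≡ ⋃𝓕
    A₁≡⋃𝓕 = head-ranked ranked≡ (∈-ranked⁺ (core-∈ ⊤) λ ⋃𝓕≡⊥ → Q≢⊥ (⊆⊥⇒≡⊥ (subst (Q ⊆_) ⋃𝓕≡⊥ Q⊆M)))
    wA₂≤wQ : weight A₂ ≤ weight Q
    wA₂≤wQ with subst (Q ∈_) ranked≡ (∈-ranked⁺ Q∈𝓕 Q≢⊥)
    ... | here Q≡A₁            = contradiction (trans Q≡A₁ A₁≡⋃𝓕) Q≢M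
    ... | there (here Q≡A₂)    = ≤-reflexive (cong weight (sym Q≡A₂))
    ... | there (there Q∈rest) = ≤ₖ⇒weight≤ (All.lookup (AllPairs.head (AllPairs.tail (sorted-from ranked≡))) Q∈rest)

  GoodPrefix : ℕ → Set
  GoodPrefix j = # 𝓕 ≤ 2 * length (take j ranked) × 2 * sum (map weight (take j ranked)) ≤ 2 ^ n

  private
    weights-sorted : AllPairs _≤_ (map weight ranked)
    weights-sorted = AllPairsₚ.map⁺ (AllPairs.map ≤ₖ⇒weight≤ ranked-sorted)

    sum-weights-take : ∀ j → sum (map weight (take j ranked)) ≡ sum (take j (map weight ranked))
    sum-weights-take j = cong sum (sym (take-map j ranked))

  goodPrefix-odd : ∀ {k} → length ranked ≡ suc (2 * k) → GoodPrefix (suc k)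
  goodPrefix-odd {k} ∣ranked∣ = #𝓕≤ , light
    where
    #𝓕≤ : # 𝓕 ≤ 2 * length (take (suc k) ranked)
    #𝓕≤ = begin
      # 𝓕                               ≤⟨ #𝓕≤1+length-ranked ⟩
      1 + length ranked                 ≡⟨ cong suc ∣ranked∣ ⟩
      2 + 2 * k                         ≡⟨ *-distribˡ-+ 2 1 k ⟨
      2 * suc k                         ≡⟨ cong (2 *_) (length-take≡ (suc k) ranked (s≤s∘m≤m+n)) ⟨
      2 * length (take (suc k) ranked)  ∎
      where
      open ≤-Reasoning
      s≤s∘m≤m+n = ≤-trans (s≤s (m≤m+n k _)) (≤-reflexive (sym ∣ranked∣))
    light : 2 * sum (map weight (take (suc k) ranked)) ≤ 2 ^ n
    light = subst (λ s → 2 * s ≤ 2 ^ n) (sym (sum-weights-take (suc k))) (≤-trans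
      (sorted⇒2*sum-take≤sum+bound k weights-sorted (Allₚ.map⁺ (All.tabulate λ _ → weight-antitone ⊥⊆ (inj₁ refl)))
                                                    (trans (length-map weight ranked) ∣ranked∣))
      sum-weights+weight-⊥≤2^n)

  goodPrefix-even : ¬ ⊥ ∈F 𝓕 → ∀ {k} → length ranked ≡ 2 * k → GoodPrefix k
  goodPrefix-even ⊥∉𝓕 {k} ∣ranked∣ = ≤-reflexive #𝓕≡2∣X∣ , light
    where
    #𝓕≡2∣X∣ : # 𝓕 ≡ 2 * length (take k ranked)
    #𝓕≡2∣X∣ = begin
      # 𝓕                         ≡⟨ #𝓕≡length-ranked ⊥∉𝓕 ⟩
      length ranked               ≡⟨ ∣ranked∣ ⟩
      2 * k                       ≡⟨ cong (2 *_) (length-take≡ k ranked k≤∣ranked∣) ⟨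
      2 * length (take k ranked)  ∎
      where
      open ≡-Reasoning
      k≤∣ranked∣ = ≤-trans (m≤m+n k _) (≤-reflexive (sym ∣ranked∣))
    light : 2 * sum (map weight (take k ranked)) ≤ 2 ^ n
    light = subst (λ s → 2 * s ≤ 2 ^ n) (sym (sum-weights-take k)) (≤-trans
      (sorted⇒2*sum-take≤sum k weights-sorted (trans (length-map weight ranked) ∣ranked∣))
      (≤-trans (m≤m+n _ (weight ⊥)) sum-weights+weight-⊥≤2^n))

  goodPrefix-with-⊥ : ⊥ ∈F 𝓕 → ∀ {A₁ A₂ rest k} → ranked ≡ A₁ ∷ A₂ ∷ rest → length rest ≡ 2 * k → GoodPrefix (2 + k)
  goodPrefix-with-⊥ ⊥∈𝓕 {A₁} {A₂} {rest} {k} ranked≡ ∣rest∣ rewrite ranked≡ = #𝓕≤ , light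
    where
    #𝓕-odd : # 𝓕 ≡ suc (2 * suc k)
    #𝓕-odd = begin
      # 𝓕               ≡⟨ #𝓕≡1+length-ranked ⊥∈𝓕 ⟩
      1 + length ranked ≡⟨ cong (λ xs → 1 + length xs) ranked≡ ⟩
      3 + length rest   ≡⟨ cong (3 +_) ∣rest∣ ⟩
      3 + 2 * k         ≡⟨ cong suc (*-distribˡ-+ 2 1 k) ⟨
      suc (2 * suc k)   ∎
      where open ≡-Reasoning
    #𝓕≤ : # 𝓕 ≤ 2 * length (take (2 + k) (A₁ ∷ A₂ ∷ rest))
    #𝓕≤ = begin
      # 𝓕                                        ≡⟨ #𝓕-odd ⟩
      suc (2 * suc k)                            ≤⟨ n≤1+n _ ⟩
      2 + 2 * suc k                              ≡⟨ *-distribˡ-+ 2 1 (suc k) ⟨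
      2 * (2 + k)                                ≡⟨ cong (λ m → 2 * (2 + m)) (length-take≡ k rest k≤∣rest∣) ⟨
      2 * length (take (2 + k) (A₁ ∷ A₂ ∷ rest)) ∎
      where
      open ≤-Reasoning
      k≤∣rest∣ = ≤-trans (m≤m+n k _) (≤-reflexive (sym ∣rest∣))
    ws↗ : AllPairs _≤_ (weight A₁ ∷ weight A₂ ∷ map weight rest)
    ws↗ = subst (λ xs → AllPairs _≤_ (map weight xs)) ranked≡ weights-sorted
    light : 2 * sum (map weight (take (2 + k) (A₁ ∷ A₂ ∷ rest))) ≤ 2 ^ n
    light = begin
      2 * sum (map weight (take (2 + k) (A₁ ∷ A₂ ∷ rest)))
        ≡⟨ cong (λ xs → 2 * (weight A₁ + (weight A₂ + sum xs))) (take-map k rest) ⟨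
      2 * sum (take (2 + k) (weight A₁ ∷ weight A₂ ∷ map weight rest))
        ≤⟨ sorted⇒2*sum-take≤sum+first-two k ws↗ (trans (length-map weight rest) ∣rest∣) ⟩
      sum (map weight (A₁ ∷ A₂ ∷ rest)) + (weight A₁ + weight A₂)
        ≤⟨ +-monoʳ-≤ _ (weight-first-two≤weight-⊥ ⊥∈𝓕 {suc k} #𝓕-odd ranked≡) ⟩
      sum (map weight (A₁ ∷ A₂ ∷ rest)) + weight ⊥
        ≤⟨ subst (λ xs → sum (map weight xs) + weight ⊥ ≤ 2 ^ n) ranked≡ sum-weights+weight-⊥≤2^n ⟩
      2 ^ n ∎
      where open ≤-Reasoning

  goodPrefix : Nontrivial 𝓕 → ∃ GoodPrefix
  goodPrefix (A , A∈𝓕 , A≠∅) with even-or-odd (length ranked) | 𝓕 ⊥ Bool.≟ true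
  ... | k , inj₂ ∣ranked∣     | _        = suc k , goodPrefix-odd {k} ∣ranked∣
  ... | k , inj₁ ∣ranked∣     | no ⊥∉𝓕  = k , goodPrefix-even ⊥∉𝓕 {k} ∣ranked∣
  ... | zero , inj₁ ∣ranked∣  | yes _    =
    contradiction (subst (0 <_) ∣ranked∣ (∈-length (∈-ranked⁺ A∈𝓕 (Nonempty⇒≢⊥ A≠∅)))) (<-irrefl refl)
  ... | suc k , inj₁ ∣ranked∣ | yes ⊥∈𝓕 with length≡2+⇒∷∷ ranked (trans ∣ranked∣ (*-distribˡ-+ 2 1 k))
  ...   | _ , _ , _ , ranked≡ , ∣rest∣ = 2 + k , goodPrefix-with-⊥ ⊥∈𝓕 {k = k} ranked≡ ∣rest∣

  halvingUpSet : Nontrivial 𝓕 → ∃ λ X → # 𝓕 ≤ 2 * # (𝓕 ∩F upClosure X) × 2 * # (upClosure X) ≤ 2 ^ n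
  halvingUpSet nontrivial with goodPrefix nontrivial
  ... | j , #𝓕≤2∣X∣ , 2ΣX≤2^n =
    take j ranked ,
    ≤-trans #𝓕≤2∣X∣ (*-monoʳ-≤ 2 (length-take≤#∩upClosure j)) ,
    ≤-trans (*-monoʳ-≤ 2 (#upClosure-take≤sum j)) 2ΣX≤2^n

theorem3p7 : (n : ℕ) (𝓕 : Family n) → Nontrivial 𝓕 → UnionClosed 𝓕 →
    ∃ λ (𝓤 : Family n) → UpSet 𝓤 × # 𝓤 ≤ 2 ^ (n ∸ 1) × # 𝓕 ≤ 2 * # (𝓕 ∩F 𝓤)
theorem3p7 zero    _ (_ , _ , () , _) _
theorem3p7 (suc m) 𝓕 nontrivial 𝓕-∪ =
  let X , half , 2#U≤2^n = Selection.halvingUpSet 𝓕 𝓕-∪ nontrivial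
  in  upClosure X , upClosure-UpSet X , *-cancelˡ-≤ 2 2#U≤2^n , half
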